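{- Let $\lambda$ be a ballot path of size $(n,n')$ and $L$ a natural label with circles of $T(\lambda)$, with insertion history $(p_1,\dots,p_{n+n'})$. Let $\sigma(L)$ be the word over $\{U,D\}$ produced by: start with the empty word; for $i=1,\dots,n+n'$: (b) if the edge labeled $i$ is undotted, insert $UD$ after the first $p_i$ letters, and if it is dotted, append $U$ at the right end; (c) if a $D$ was inserted in (b), move that $D$ to the right end of the word; (d) if the edge labeled $i$ is circled, replace the rightmost letter $D$ by $U$. Then $\sigma(L)$ is the top boundary path of the fundamental symmetric Dyck tiling $\mathrm{symDTS}(L)$.
   Context: Paths use steps $U=(1,1)$, $D=(1,-1)$; a ballot path of size $(n,n')$ goes from $(0,0)$ to $(2n+n',n')$ never below $y=0$. Boxes are unit squares rotated $45^\circ$ centered at lattice points; Dyck (resp. ballot) tiles are ribbons of boxes whose centers form a translate of a Dyck (resp. ballot) path. A fundamental symmetric Dyck tiling above $\lambda$ is the part $x\le N=2n+n'$ of a cover-inclusive Dyck tiling above $\lambda$ followed by its mirror image that is invariant under $x\mapsto 2N-x$ (boxes centered on $x=N$ marked $\ast$); its top boundary is its upper ballot path. Tree $T(\lambda)$: in $\overline\lambda=\lambda D^{n'}$ each matched up/down pair is an edge, nesting gives parent/child, ordered left to right; dotted if its down step is one of the appended $D$'s. A natural label with circles labels the edges bijectively by $1,\dots,n+n'$, increasing from root to leaves, with circles on some undotted edges. $E'$ is strictly left of $E$ if the down step of $E'$ precedes the up step of $E$ in $\overline\lambda$. Insertion history: $p_i=2\#\{j<i: E(j)\text{ strictly left of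 }E(i)\}+\#\{j<i:E(j)\text{ ancestor of }E(i)\}$, $E(i)$ being the edge labeled $i$. symDTS: start from the empty tiling; at step $k$: (1) if $E(k)$ is undotted perform a Dyck spread at $x=p_k$ (keep points with $x\le s$, add $(s+1,y+1)$ above $(s,y)$, send $(x,y)$ with $x\ge s$ to $(x+2,y)$, applied to the boundary paths and to each tile viewed as the path of its box centers), if dotted a ballot spread at $x=p_k$ (keep $x\le s$, send $(x,y)$ with $x\ge s$ to $(x+1,y+1)$); (2) add a single box on each up step of the new top path lying to the right of the newly inserted step(s) (box with that up step as south-east edge); (3) if $E(k)$ is circled, add a box marked $\ast$ whose south-west edge is the last step of the top path. -}

module Defs where

open import Data.Nat using (ℕ; zero; suc; _+_; _*_; _<_; _≤ᵇ_; _<ᵇ_; _≡ᵇ_)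
open import Data.Integer as ℤ using (ℤ; +_) renaming (_<_ to _<ℤ_; _≤_ to _≤ℤ_)
open import Data.Bool using (Bool; true; false; if_then_else_; _∧_)
open import Data.List using (List; []; _∷_; _++_; [_]; length; take; drop; reverse; map; concatMap; foldl; replicate)
open import Data.Fin using (Fin; toℕ) renaming (_<_ to _<F_)
open import Data.List using () renaming (allFin to allFinL)
open import Data.Maybe using (Maybe; just; nothing)
open import Data.Product using (_×_; _,_; ∃)
open import Relation.Nullary using (does)
open import Relation.Binary.PropositionalEquality using (_≡_)

data Step : Set where
  U D : Step

Word : Set
Word = List Step

at : Word → ℕ → Maybe Step
at []      _       = nothing
at (s ∷ w) zero    = just s
at (s ∷ w) (suc k) = at w k

height : Word → ℤ
height []      = + 0
height (U ∷ w) = ℤ.suc (height w)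
height (D ∷ w) = ℤ.pred (height w)

heightAt : Word → ℕ → ℤ
heightAt w k = height (take k w)

IsBallot : ℕ → ℕ → Word → Set
IsBallot n n' w =
  (length w ≡ 2 * n + n') × (height w ≡ + n') ×
  (∀ k → k Data.Nat.≤ length w → + 0 ≤ℤ heightAt w k)

bar : ℕ → Word → Word
bar n' w = w ++ replicate n' D

-- (i , j) is a matched up/down pair (= an edge of T(λ)) of the word v:
-- up step at position i, matching down step at position j (0-based)
IsEdge : Word → ℕ → ℕ → Set
IsEdge v i j =
  (at v i ≡ just U) × (at v j ≡ just D) × (i < j) ×
  (heightAt v (suc j) ≡ heightAt v i) ×
  (∀ k → i < k → k Data.Nat.≤ j → heightAt v i <ℤ heightAt v k)

-- Labels 1,…,m (m = n+n') are represented by Fin m (label i+1 ↦ i).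
-- The edge labelled i is given by the positions (up i , dn i) of its up
-- and down steps in λ̄.

record NatLabelCirc (w : Word) (n' m : ℕ) : Set where
  field
    up dn     : Fin m → ℕ
    isEdge    : ∀ i → IsEdge (bar n' w) (up i) (dn i)
    injective : ∀ i j → up i ≡ up j → i ≡ j
    surjective : ∀ a b → IsEdge (bar n' w) a b → ∃ λ i → up i ≡ a
    -- increasing from the root to the leaves: an ancestor edge has a
    -- smaller label than its descendants
    increasing : ∀ i j → up j < up i → dn i < dn j → j <F i
    circled   : Fin m → Bool
    -- circles only on undotted edges (dotted = down step is an appended D)
    circled-undotted : ∀ i → circled i ≡ true → dn i < length w

module _ {w : Word} {n' m : ℕ} (L : NatLabelCirc w n' m) where
  open NatLabelCirc L

  dotted : Fin m → Bool
  dotted i = length w ≤ᵇ dn i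

  countB : {A : Set} → (A → Bool) → List A → ℕ
  countB P []       = 0
  countB P (x ∷ xs) = if P x then suc (countB P xs) else countB P xs

  strictlyLeft : Fin m → Fin m → Bool
  strictlyLeft j i = dn j <ᵇ up i

  ancestor : Fin m → Fin m → Bool
  ancestor j i = (up j <ᵇ up i) ∧ (dn i <ᵇ dn j)

  hist : Fin m → ℕ
  hist i = 2 * countB (λ j → (toℕ j <ᵇ toℕ i) ∧ strictlyLeft j i) (allFinL m)
             + countB (λ j → (toℕ j <ᵇ toℕ i) ∧ ancestor j i) (allFinL m)

  insertUD : ℕ → Word → Word
  insertUD p v = take p v ++ U ∷ D ∷ drop p v

  moveDToEnd : ℕ → Word → Word
  moveDToEnd k v = take k v ++ drop (suc k) v ++ [ D ]

  replaceFirstD : Word → Word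
  replaceFirstD []      = []
  replaceFirstD (U ∷ v) = U ∷ replaceFirstD v
  replaceFirstD (D ∷ v) = U ∷ v

  replaceLastD : Word → Word
  replaceLastD v = reverse (replaceFirstD (reverse v))

  σStep : Word → Fin m → Word
  σStep v i =
    let v' = if dotted i then v ++ [ U ]
                         else moveDToEnd (suc (hist i)) (insertUD (hist i) v)
    in if circled i then replaceLastD v' else v'

  sigma : Word
  sigma = foldl σStep [] (allFinL m)

  -- lattice points (x , y); boxes are identified with their centers,
  -- paths and tiles with their lists of points
  Pt : Set
  Pt = ℕ × ℤ

  dyckSpreadPt : ℕ → Pt → List Pt
  dyckSpreadPt s (x , y) =
    if x <ᵇ s then [ (x , y) ]
    else if x ≡ᵇ s then (x , y) ∷ (suc s , ℤ.suc y) ∷ (suc (suc s) , y) ∷ []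
    else [ (suc (suc x) , y) ]

  ballotSpreadPt : ℕ → Pt → List Pt
  ballotSpreadPt s (x , y) =
    if x <ᵇ s then [ (x , y) ]
    else if x ≡ᵇ s then (x , y) ∷ (suc s , ℤ.suc y) ∷ []
    else [ (suc x , ℤ.suc y) ]

  -- a tile: list of box centers, with a flag telling whether it is a box marked ∗
  Tile : Set
  Tile = List Pt × Bool

  record Tiling : Set where
    constructor tiling
    field
      top    : List Pt
      bottom : List Pt
      tiles  : List Tile

  emptyTiling : Tiling
  emptyTiling = tiling [ (0 , + 0) ] [ (0 , + 0) ] []

  spreadTiling : (Pt → List Pt) → Tiling → Tiling
  spreadTiling f (tiling t b ts) =
    tiling (concatMap f t) (concatMap f b) (map (λ { (ps , st) → (concatMap f ps , st) }) ts)

  -- centers of the boxes having an up step (x,y)→(x+1,y+1) of the path,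
  -- with x ≥ t, as south-east edge
  upBoxes : ℕ → List Pt → List Pt
  upBoxes t []                         = []
  upBoxes t ((x , y) ∷ [])             = []
  upBoxes t ((x , y) ∷ rest@((x' , y') ∷ _)) =
    if (t ≤ᵇ x) ∧ does (y' ℤ.≟ ℤ.suc y)
    then (x , ℤ.suc y) ∷ upBoxes t rest
    else upBoxes t rest

  -- new top path after adding the box centered at c on top of the path:
  -- the bottom vertex (cx , cy-1) of the box is replaced by its top vertex
  addBoxTop : Pt → List Pt → List Pt
  addBoxTop (cx , cy) =
    map (λ { (x , y) → if (x ≡ᵇ cx) ∧ does (y ℤ.≟ ℤ.pred cy) then (x , ℤ.suc cy) else (x , y) })

  addBoxes : List Pt → Bool → Tiling → Tiling
  addBoxes cs st (tiling t b ts) =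
    tiling (foldl (λ p c → addBoxTop c p) t cs) b (ts ++ map (λ c → ([ c ] , st)) cs)

  lastStepStart : List Pt → Maybe Pt
  lastStepStart []           = nothing
  lastStepStart (a ∷ [])     = nothing
  lastStepStart (a ∷ b ∷ []) = just a
  lastStepStart (a ∷ rest@(b ∷ c ∷ _)) = lastStepStart rest

  -- box marked ∗ whose south-west edge is the last step of the top path
  addStarBox : Tiling → Tiling
  addStarBox T with lastStepStart (Tiling.top T)
  ... | nothing      = T
  ... | just (x , y) = addBoxes [ (suc x , y) ] true T

  dtsStep : Tiling → Fin m → Tiling
  dtsStep T k =
    let s  = hist k
        T₁ = if dotted k then spreadTiling (ballotSpreadPt s) T
                         else spreadTiling (dyckSpreadPt s) T
        -- first x-coordinate to the right of the newly inserted step(s)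
        r  = if dotted k then suc s else suc (suc s)
        T₂ = addBoxes (upBoxes r (Tiling.top T₁)) false T₁
    in if circled k then addStarBox T₂ else T₂

  symDTS : Tiling
  symDTS = foldl dtsStep emptyTiling (allFinL m)

pathFrom : ℕ × ℤ → Word → List (ℕ × ℤ)
pathFrom (x , y) []      = [ (x , y) ]
pathFrom (x , y) (U ∷ w) = (x , y) ∷ pathFrom (suc x , ℤ.suc y) w
pathFrom (x , y) (D ∷ w) = (x , y) ∷ pathFrom (suc x , ℤ.pred y) w

pathOf : Word → List (ℕ × ℤ)
pathOf = pathFrom (0 , + 0)

-- Both σ(L) and symDTS(L) are folds over the labels 1, …, n+n′, so it suffices that one step of
-- symDTS acts on the top path as the corresponding step of σ acts on the word, as long as the
-- current word has length Σ_{j<i} (2 if E(j) is undotted, 1 if dotted) ≥ p_i, with equality when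
-- E(i) is dotted.  A Dyck spread at p inserts a peak UD after p letters, and a box on every later
-- up step turns the remainder of the path into the same remainder followed by D: this is moving
-- the inserted D to the end.  A ballot spread at the end appends U and leaves no up step to its
-- right, and the ∗ box turns the final D into U.  The length bounds hold because an earlier edge
-- adds 2 to p_i only when it lies strictly left of E(i), which forces it to be undotted, and at
-- most 1 otherwise; while an edge labelled before a dotted E(i) is either undotted and strictly
-- left of it, or dotted and an ancestor of it.

module Submission where

open import Defs
open import Data.Bool using (Bool; true; false; if_then_else_; _∧_)
open import Data.Bool.Properties using (∧-zeroʳ)
open import Data.Empty using (⊥-elim)
open import Data.Fin as Fin using (Fin; toℕ)
open import Data.Integer as ℤ using (ℤ; +_)
import Data.Integer.Properties as ℤ
open import Data.List using (List; []; _∷_; _++_; [_]; length; take; drop; reverse; replicate; map; concatMap; foldl; allFin)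
open import Data.List.Properties
  using (map-cong; map-cong-local; map-∘; map-id; map-++; length-++; length-++-sucʳ; length-take; take++drop≡id;
         ++-assoc; reverse-++; reverse-involutive)
open import Data.List.Relation.Unary.All as All using (All; []; _∷_)
open import Data.List.Relation.Unary.All.Properties using (++⁻ʳ)
open import Data.List.Relation.Unary.AllPairs using (AllPairs; []; _∷_)
open import Data.List.Relation.Unary.AllPairs.Properties using (tabulate⁺-<)
open import Data.Maybe using (just)
open import Data.Nat
open import Data.Nat.ListAction using (sum)
open import Data.Nat.ListAction.Properties using (sum-++)
open import Data.Nat.Properties
open import Data.Nat.Tactic.RingSolver using (solve-∀)
open import Data.Product using (_×_; _,_; proj₁; proj₂; ∃)
open import Data.Sum using (_⊎_; inj₁; inj₂)
open import Function using (_∘_; id)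
open import Relation.Binary using (tri<; tri≈; tri>)
open import Relation.Binary.PropositionalEquality hiding ([_])
open import Relation.Nullary using (does; ¬_; yes; no; contradiction)
open import Relation.Nullary.Decidable using (dec-true; dec-false)

≡ᵇ-false : ∀ {m n} → m ≢ n → (m ≡ᵇ n) ≡ false
≡ᵇ-false = dec-false (_ ≟ _)

<ᵇ-true : ∀ {m n} → m < n → (m <ᵇ n) ≡ true
<ᵇ-true = dec-true (_ <? _)

<ᵇ-false : ∀ {m n} → ¬ m < n → (m <ᵇ n) ≡ false
<ᵇ-false = dec-false (_ <? _)

≤ᵇ-true : ∀ {m n} → m ≤ n → (m ≤ᵇ n) ≡ true
≤ᵇ-true = dec-true (_ ≤? _)

≤ᵇ-false : ∀ {m n} → ¬ m ≤ n → (m ≤ᵇ n) ≡ false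
≤ᵇ-false = dec-false (_ ≤? _)

≡ᵇ-refl : ∀ x → (x ≡ᵇ x) ≡ true
≡ᵇ-refl x = dec-true (x ≟ x) refl

≟-refl : ∀ (i : ℤ) → does (i ℤ.≟ i) ≡ true
≟-refl i = dec-true (i ℤ.≟ i) refl

pred≢suc : ∀ i → ℤ.pred i ≢ ℤ.suc i
pred≢suc i eq =
  ℤ.<-irrefl eq (ℤ.<-trans (ℤ.i≤pred[j]⇒i<j {j = i} ℤ.≤-refl) (ℤ.suc[i]≤j⇒i<j {i = i} ℤ.≤-refl))

AllPairs-++-∷⁻ : ∀ {A : Set} {R : A → A → Set} xs y zs → AllPairs R (xs ++ y ∷ zs) →
  All (λ x → R x y) xs × All (R y) zs
AllPairs-++-∷⁻ []       y zs (Ry ∷ _)    = [] , Ry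
AllPairs-++-∷⁻ (x ∷ xs) y zs (Rx ∷ rest) with AllPairs-++-∷⁻ xs y zs rest
... | before , after = All.head (++⁻ʳ xs Rx) ∷ before , after

allFin-split : ∀ {m} ys (i : Fin m) zs → ys ++ i ∷ zs ≡ allFin m →
  All (λ j → toℕ j < toℕ i) ys × All (λ j → toℕ i < toℕ j) zs
allFin-split ys i zs split = AllPairs-++-∷⁻ ys i zs (subst (AllPairs Fin._<_) (sym split) (tabulate⁺-< id))

length-snoc : ∀ (v : Word) c → length (v ++ [ c ]) ≡ suc (length v)
length-snoc v c = trans (length-++ v {[ c ]}) (+-comm (length v) 1)

length-snoc-two : ∀ (v : Word) c {n} → length v ≡ suc n → length (v ++ [ c ]) ≡ n + 2
length-snoc-two v c {n} len = trans (length-snoc v c) (trans (cong suc len) (+-comm 2 n))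

fromBool : Bool → ℕ
fromBool true  = 1
fromBool false = 0

Point : Set
Point = ℕ × ℤ

move : Step → ℤ → ℤ
move U = ℤ.suc
move D = ℤ.pred

pathFrom-∷ : ∀ c x y v → pathFrom (x , y) (c ∷ v) ≡ (x , y) ∷ pathFrom (suc x , move c y) v
pathFrom-∷ U x y v = refl
pathFrom-∷ D x y v = refl

RightOf : ℕ → List Point → Set
RightOf k = All (λ q → k ≤ proj₁ q)

pathFrom-rightOf : ∀ x y v → RightOf x (pathFrom (x , y) v)
pathFrom-rightOf x y []      = ≤-refl ∷ []
pathFrom-rightOf x y (c ∷ v) rewrite pathFrom-∷ c x y v =
  ≤-refl ∷ All.map (≤-trans (n≤1+n x)) (pathFrom-rightOf (suc x) (move c y) v)

module _ {w : Word} {n' m : ℕ} (L : NatLabelCirc w n' m) where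

  boxLift : Point → Point → Point
  boxLift (cx , cy) (x , y) = if (x ≡ᵇ cx) ∧ does (y ℤ.≟ ℤ.pred cy) then (x , ℤ.suc cy) else (x , y)

  boxLifts : List Point → Point → Point
  boxLifts cs q = foldl (λ q′ c → boxLift c q′) q cs

  addBoxes-top : ∀ cs st (T : Tiling L) → Tiling.top (addBoxes L cs st T) ≡ map (boxLifts cs) (Tiling.top T)
  addBoxes-top cs st T = go cs (Tiling.top T)
    where
    go : ∀ cs P → foldl (λ p c → addBoxTop L c p) P cs ≡ map (boxLifts cs) P
    go []       P = sym (map-id P)
    go (c ∷ cs) P = begin
      foldl (λ p c → addBoxTop L c p) (addBoxTop L c P) cs ≡⟨ go cs (addBoxTop L c P) ⟩
      map (boxLifts cs) (addBoxTop L c P)                  ≡⟨ cong (map (boxLifts cs)) (map-cong (λ _ → refl) P) ⟩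
      map (boxLifts cs) (map (boxLift c) P)                ≡⟨ map-∘ P ⟨
      map (boxLifts (c ∷ cs)) P                            ∎
      where open ≡-Reasoning

  boxLift-off : ∀ c {x} y → x ≢ proj₁ c → boxLift c (x , y) ≡ (x , y)
  boxLift-off (cx , cy) y x≢cx rewrite ≡ᵇ-false x≢cx = refl

  boxLift-under : ∀ x y → boxLift (x , y) (x , ℤ.pred y) ≡ (x , ℤ.suc y)
  boxLift-under x y rewrite ≡ᵇ-refl x | ≟-refl (ℤ.pred y) = refl

  boxLifts-left : ∀ {k x} y cs → x < k → RightOf k cs → boxLifts cs (x , y) ≡ (x , y)
  boxLifts-left y []       x<k []         = refl
  boxLifts-left y (c ∷ cs) x<k (k≤c ∷ ks) rewrite boxLift-off c y (<⇒≢ (<-≤-trans x<k k≤c)) =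
    boxLifts-left y cs x<k ks

  map-boxLift-right : ∀ {k} c P → proj₁ c < k → RightOf k P → map (boxLift c) P ≡ P
  map-boxLift-right c P c<k k≤P =
    trans (map-cong-local (All.map (λ k≤q → boxLift-off c _ (>⇒≢ (<-≤-trans c<k k≤q))) k≤P)) (map-id P)

  upBoxes-rightOf : ∀ {k} t P → RightOf k P → RightOf k (upBoxes L t P)
  upBoxes-rightOf t []                              _        = []
  upBoxes-rightOf t (_ ∷ [])                        _        = []
  upBoxes-rightOf t ((x , y) ∷ (x′ , y′) ∷ P) (k≤x ∷ k≤P) with (t ≤ᵇ x) ∧ does (y′ ℤ.≟ ℤ.suc y)
  ... | true  = k≤x ∷ upBoxes-rightOf t ((x′ , y′) ∷ P) k≤P
  ... | false = upBoxes-rightOf t ((x′ , y′) ∷ P) k≤P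

  upBoxes-skip : ∀ t q P → ¬ t ≤ proj₁ q → upBoxes L t (q ∷ P) ≡ upBoxes L t P
  upBoxes-skip t q []      _   = refl
  upBoxes-skip t q (_ ∷ _) t≰q rewrite ≤ᵇ-false t≰q = refl

  upBoxes-pathFrom : ∀ t x y x′ y′ v → upBoxes L t ((x , y) ∷ pathFrom (x′ , y′) v) ≡
    (if (t ≤ᵇ x) ∧ does (y′ ℤ.≟ ℤ.suc y)
     then (x , ℤ.suc y) ∷ upBoxes L t (pathFrom (x′ , y′) v)
     else upBoxes L t (pathFrom (x′ , y′) v))
  upBoxes-pathFrom t x y x′ y′ []      = refl
  upBoxes-pathFrom t x y x′ y′ (U ∷ v) = refl
  upBoxes-pathFrom t x y x′ y′ (D ∷ v) = refl

  upBoxes-none : ∀ t x y v → x + length v ≤ t → upBoxes L t (pathFrom (x , y) v) ≡ []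
  upBoxes-none t x y []      _ = refl
  upBoxes-none t x y (c ∷ v) x+v<t rewrite pathFrom-∷ c x y v | +-suc x (length v) =
    trans (upBoxes-skip t (x , y) (pathFrom (suc x , move c y) v) (<⇒≱ (<-≤-trans (s≤s (m≤m+n x (length v))) x+v<t)))
          (upBoxes-none t (suc x) (move c y) v x+v<t)

  -- Each vertex starting an up step is raised by two, so the path of v entered by a down step
  -- becomes the path of v D.
  upBoxes-lift : ∀ t x y v → t ≤ suc x → let P = pathFrom (suc x , ℤ.pred y) v in
    (x , y) ∷ map (boxLifts (upBoxes L t P)) P ≡ pathFrom (x , y) (v ++ [ D ])
  upBoxes-lift t x y []      _ = refl
  upBoxes-lift t x y (U ∷ v) t≤x
    rewrite upBoxes-pathFrom t (suc x) (ℤ.pred y) (suc (suc x)) (ℤ.suc (ℤ.pred y)) v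
          | ≤ᵇ-true t≤x | ≟-refl (ℤ.suc (ℤ.pred y)) | ℤ.suc-pred y =
    cong ((x , y) ∷_) (trans (cong₂ _∷_ peak-lifted rest-untouched) lifted)
    where
    P : List Point
    P = pathFrom (suc (suc x) , y) v
    cs : List Point
    cs = upBoxes L t P
    c : Point
    c = (suc x , y)
    x+2≤P : RightOf (suc (suc x)) P
    x+2≤P = pathFrom-rightOf (suc (suc x)) y v
    peak-lifted : boxLifts cs (boxLift c (suc x , ℤ.pred y)) ≡ (suc x , ℤ.suc y)
    peak-lifted = trans (cong (boxLifts cs) (boxLift-under (suc x) y))
                 (boxLifts-left (ℤ.suc y) cs ≤-refl (upBoxes-rightOf t P x+2≤P))
    rest-untouched : map (boxLifts (c ∷ cs)) P ≡ map (boxLifts cs) P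
    rest-untouched = trans (map-∘ P) (cong (map (boxLifts cs)) (map-boxLift-right c P ≤-refl x+2≤P))
    lifted : (suc x , ℤ.suc y) ∷ map (boxLifts cs) P ≡ pathFrom (suc x , ℤ.suc y) (v ++ [ D ])
    lifted = subst (λ z → (suc x , ℤ.suc y) ∷ map (boxLifts (upBoxes L t (pathFrom (suc (suc x) , z) v)))
                                                    (pathFrom (suc (suc x) , z) v)
                          ≡ pathFrom (suc x , ℤ.suc y) (v ++ [ D ]))
                   (ℤ.pred-suc y) (upBoxes-lift t (suc x) (ℤ.suc y) v (m≤n⇒m≤1+n t≤x))
  upBoxes-lift t x y (D ∷ v) t≤x
    rewrite upBoxes-pathFrom t (suc x) (ℤ.pred y) (suc (suc x)) (ℤ.pred (ℤ.pred y)) v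
          | ≤ᵇ-true t≤x | dec-false (ℤ.pred (ℤ.pred y) ℤ.≟ ℤ.suc (ℤ.pred y)) (pred≢suc (ℤ.pred y)) =
    cong ((x , y) ∷_) (trans (cong (_∷ map (boxLifts (upBoxes L t P)) P) valley-fixed)
                             (upBoxes-lift t (suc x) (ℤ.pred y) v (m≤n⇒m≤1+n t≤x)))
    where
    P : List Point
    P = pathFrom (suc (suc x) , ℤ.pred (ℤ.pred y)) v
    valley-fixed : boxLifts (upBoxes L t P) (suc x , ℤ.pred y) ≡ (suc x , ℤ.pred y)
    valley-fixed = boxLifts-left _ (upBoxes L t P) ≤-refl
             (upBoxes-rightOf t P (pathFrom-rightOf (suc (suc x)) _ v))

  dyckSpreadPt-left : ∀ {s x} y → x < s → dyckSpreadPt L s (x , y) ≡ [ (x , y) ]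
  dyckSpreadPt-left y x<s rewrite <ᵇ-true x<s = refl

  dyckSpreadPt-right : ∀ {s x} y → s < x → dyckSpreadPt L s (x , y) ≡ [ (suc (suc x) , y) ]
  dyckSpreadPt-right y s<x rewrite <ᵇ-false (<⇒≯ s<x) | ≡ᵇ-false (>⇒≢ s<x) = refl

  dyckSpreadPt-at : ∀ x y → dyckSpreadPt L x (x , y) ≡ (x , y) ∷ (suc x , ℤ.suc y) ∷ (suc (suc x) , y) ∷ []
  dyckSpreadPt-at x y rewrite <ᵇ-false (<-irrefl {x} refl) | ≡ᵇ-refl x = refl

  dyckSpread-right : ∀ {s x} y v → s < x →
    concatMap (dyckSpreadPt L s) (pathFrom (x , y) v) ≡ pathFrom (suc (suc x) , y) v
  dyckSpread-right y [] s<x rewrite dyckSpreadPt-right y s<x = refl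
  dyckSpread-right {x = x} y (c ∷ v) s<x
    rewrite pathFrom-∷ c x y v | pathFrom-∷ c (suc (suc x)) y v | dyckSpreadPt-right y s<x =
    cong ((suc (suc x) , y) ∷_) (dyckSpread-right (move c y) v (m<n⇒m<1+n s<x))

  dyckSpread-at : ∀ x y v → concatMap (dyckSpreadPt L x) (pathFrom (x , y) v) ≡ pathFrom (x , y) (U ∷ D ∷ v)
  dyckSpread-at x y [] rewrite dyckSpreadPt-at x y | ℤ.pred-suc y = refl
  dyckSpread-at x y (c ∷ v)
    rewrite pathFrom-∷ c x y v | dyckSpreadPt-at x y | ℤ.pred-suc y | pathFrom-∷ c (suc (suc x)) y v =
    cong (λ P → (x , y) ∷ (suc x , ℤ.suc y) ∷ (suc (suc x) , y) ∷ P) (dyckSpread-right (move c y) v ≤-refl)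

  dyckSpread-inserts-peak : ∀ x y A B →
    concatMap (dyckSpreadPt L (x + length A)) (pathFrom (x , y) (A ++ B)) ≡ pathFrom (x , y) (A ++ U ∷ D ∷ B)
  dyckSpread-inserts-peak x y [] B rewrite +-identityʳ x = dyckSpread-at x y B
  dyckSpread-inserts-peak x y (c ∷ A) B
    rewrite pathFrom-∷ c x y (A ++ B) | pathFrom-∷ c x y (A ++ U ∷ D ∷ B) | +-suc x (length A)
          | dyckSpreadPt-left {suc (x + length A)} y (s≤s (m≤m+n x (length A))) =
    cong ((x , y) ∷_) (dyckSpread-inserts-peak (suc x) (move c y) A B)

  upBoxes-after-peak : ∀ x y A B → let P = pathFrom (x , y) (A ++ U ∷ D ∷ B) in
    map (boxLifts (upBoxes L (suc (suc (x + length A))) P)) P ≡ pathFrom (x , y) ((A ++ U ∷ B) ++ [ D ])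
  upBoxes-after-peak x y [] B rewrite +-identityʳ x = begin
    map (boxLifts (upBoxes L (suc (suc x)) P)) P
      ≡⟨ cong (λ cs → map (boxLifts cs) P) skip-peak ⟩
    map (boxLifts cs) P
      ≡⟨ cong₂ (λ p q → p ∷ q ∷ map (boxLifts cs) P′) (fixed y (m<n⇒m<1+n ≤-refl)) (fixed (ℤ.suc y) ≤-refl) ⟩
    (x , y) ∷ (suc x , ℤ.suc y) ∷ map (boxLifts cs) P′
      ≡⟨ cong ((x , y) ∷_) (upBoxes-lift (suc (suc x)) (suc x) (ℤ.suc y) B ≤-refl) ⟩
    pathFrom (x , y) (U ∷ B ++ [ D ])
      ∎
    where
    open ≡-Reasoning
    P′ P cs : List Point
    P′ = pathFrom (suc (suc x) , ℤ.pred (ℤ.suc y)) B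
    P  = (x , y) ∷ (suc x , ℤ.suc y) ∷ P′
    cs = upBoxes L (suc (suc x)) P′
    skip-peak : upBoxes L (suc (suc x)) P ≡ cs
    skip-peak = trans (upBoxes-skip (suc (suc x)) (x , y) ((suc x , ℤ.suc y) ∷ P′) (<⇒≱ (m<n⇒m<1+n ≤-refl)))
                      (upBoxes-skip (suc (suc x)) (suc x , ℤ.suc y) P′ (<⇒≱ ≤-refl))
    fixed : ∀ {x′} y′ → x′ < suc (suc x) → boxLifts cs (x′ , y′) ≡ (x′ , y′)
    fixed y′ x′<x+2 = boxLifts-left y′ cs x′<x+2 (upBoxes-rightOf (suc (suc x)) P′ (pathFrom-rightOf (suc (suc x)) _ B))
  upBoxes-after-peak x y (c ∷ A) B
    rewrite pathFrom-∷ c x y (A ++ U ∷ D ∷ B) | pathFrom-∷ c x y ((A ++ U ∷ B) ++ [ D ]) | +-suc x (length A) =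
    trans (cong (λ cs → map (boxLifts cs) ((x , y) ∷ P)) (upBoxes-skip t (x , y) P (<⇒≱ x<t)))
          (cong₂ _∷_ (boxLifts-left y (upBoxes L t P) ≤-refl (upBoxes-rightOf t P (pathFrom-rightOf (suc x) _ _)))
                     (upBoxes-after-peak (suc x) (move c y) A B))
    where
    t : ℕ
    t = suc (suc (suc (x + length A)))
    P : List Point
    P = pathFrom (suc x , move c y) (A ++ U ∷ D ∷ B)
    x<t : x < t
    x<t = m<n⇒m<1+n (m<n⇒m<1+n (s≤s (m≤m+n x (length A))))

  ballotSpread-appends-up : ∀ x y A →
    concatMap (ballotSpreadPt L (x + length A)) (pathFrom (x , y) A) ≡ pathFrom (x , y) (A ++ [ U ])
  ballotSpread-appends-up x y [] rewrite +-identityʳ x | <ᵇ-false (<-irrefl {x} refl) | ≡ᵇ-refl x = refl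
  ballotSpread-appends-up x y (c ∷ A)
    rewrite pathFrom-∷ c x y A | pathFrom-∷ c x y (A ++ [ U ]) | +-suc x (length A)
          | <ᵇ-true (s≤s (m≤m+n x (length A))) =
    cong ((x , y) ∷_) (ballotSpread-appends-up (suc x) (move c y) A)

  pathEnd : Point → Word → Point
  pathEnd q             []      = q
  pathEnd (x , y)       (c ∷ v) = pathEnd (suc x , move c y) v

  pathEnd-rightOf : ∀ x y v → x ≤ proj₁ (pathEnd (x , y) v)
  pathEnd-rightOf x y []      = ≤-refl
  pathEnd-rightOf x y (c ∷ v) = <⇒≤ (pathEnd-rightOf (suc x) (move c y) v)

  length-pathFrom : ∀ x y v → length (pathFrom (x , y) v) ≡ suc (length v)
  length-pathFrom x y []      = refl
  length-pathFrom x y (c ∷ v) rewrite pathFrom-∷ c x y v = cong suc (length-pathFrom (suc x) (move c y) v)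

  lastStepStart-∷ : ∀ a P → 2 ≤ length P → lastStepStart L (a ∷ P) ≡ lastStepStart L P
  lastStepStart-∷ a (b ∷ [])    (s≤s ())
  lastStepStart-∷ a (b ∷ c ∷ P) _        = refl

  lastStepStart-snocD : ∀ x y v → lastStepStart L (pathFrom (x , y) (v ++ [ D ])) ≡ just (pathEnd (x , y) v)
  lastStepStart-snocD x y []      = refl
  lastStepStart-snocD x y (c ∷ v) rewrite pathFrom-∷ c x y (v ++ [ D ]) =
    trans (lastStepStart-∷ (x , y) (pathFrom (suc x , move c y) (v ++ [ D ])) two≤) (lastStepStart-snocD (suc x) (move c y) v)
    where
    two≤ : 2 ≤ length (pathFrom (suc x , move c y) (v ++ [ D ]))
    two≤ rewrite length-pathFrom (suc x) (move c y) (v ++ [ D ]) | length-++ v {[ D ]} =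
      s≤s (m≤n+m 1 (length v))

  starBox-lifts : ∀ x y v → let (ex , ey) = pathEnd (x , y) v in
    map (boxLift (suc ex , ey)) (pathFrom (x , y) (v ++ [ D ])) ≡ pathFrom (x , y) (v ++ [ U ])
  starBox-lifts x y [] = cong₂ _∷_ (boxLift-off (suc x , y) y (<⇒≢ (n<1+n x))) (cong (_∷ []) (boxLift-under (suc x) y))
  starBox-lifts x y (c ∷ v) rewrite pathFrom-∷ c x y (v ++ [ D ]) | pathFrom-∷ c x y (v ++ [ U ]) =
    cong₂ _∷_ (boxLift-off (suc ex , ey) y (<⇒≢ (s≤s (<⇒≤ (pathEnd-rightOf (suc x) (move c y) v)))))
              (starBox-lifts (suc x) (move c y) v)
    where
    ex : ℕ
    ex = proj₁ (pathEnd (suc x , move c y) v)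
    ey : ℤ
    ey = proj₂ (pathEnd (suc x , move c y) v)

  addStarBox-top : ∀ (T : Tiling L) v → Tiling.top T ≡ pathOf (v ++ [ D ]) →
    Tiling.top (addStarBox L T) ≡ pathOf (v ++ [ U ])
  addStarBox-top T v top≡ rewrite top≡ | lastStepStart-snocD 0 (+ 0) v =
    trans (addBoxes-top [ c ] true T) (trans (cong (map (boxLift c)) top≡) (starBox-lifts 0 (+ 0) v))
    where
    c : Point
    c = (suc (proj₁ (pathEnd (0 , + 0) v)) , proj₂ (pathEnd (0 , + 0) v))

  moveDToEnd-peak : ∀ A B → moveDToEnd L (suc (length A)) (A ++ U ∷ D ∷ B) ≡ (A ++ U ∷ B) ++ [ D ]
  moveDToEnd-peak []      B = refl
  moveDToEnd-peak (c ∷ A) B = cong (c ∷_) (moveDToEnd-peak A B)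

  replaceLastD-snoc : ∀ v → replaceLastD L (v ++ [ D ]) ≡ v ++ [ U ]
  replaceLastD-snoc v rewrite reverse-++ v [ D ] | reverse-++ [ U ] (reverse v) | reverse-involutive v = refl

  dyckInsertion-top : ∀ A B (T : Tiling L) → Tiling.top T ≡ pathOf (A ++ B) →
    let T₁ = spreadTiling L (dyckSpreadPt L (length A)) T in
    Tiling.top (addBoxes L (upBoxes L (suc (suc (length A))) (Tiling.top T₁)) false T₁) ≡ pathOf ((A ++ U ∷ B) ++ [ D ])
  dyckInsertion-top A B T top≡ =
    trans (addBoxes-top (upBoxes L (suc (suc (length A))) (Tiling.top T₁)) false T₁)
          (trans (cong (λ P → map (boxLifts (upBoxes L (suc (suc (length A))) P)) P) spread≡)
                 (upBoxes-after-peak 0 (+ 0) A B))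
    where
    T₁ : Tiling L
    T₁ = spreadTiling L (dyckSpreadPt L (length A)) T
    spread≡ : Tiling.top T₁ ≡ pathOf (A ++ U ∷ D ∷ B)
    spread≡ = trans (cong (concatMap (dyckSpreadPt L (length A))) top≡) (dyckSpread-inserts-peak 0 (+ 0) A B)

  ballotInsertion-top : ∀ s (T : Tiling L) → Tiling.top T ≡ pathOf s →
    let T₁ = spreadTiling L (ballotSpreadPt L (length s)) T in
    Tiling.top (addBoxes L (upBoxes L (suc (length s)) (Tiling.top T₁)) false T₁) ≡ pathOf (s ++ [ U ])
  ballotInsertion-top s T top≡ =
    trans (addBoxes-top (upBoxes L (suc (length s)) (Tiling.top T₁)) false T₁)
          (trans (cong (λ P → map (boxLifts (upBoxes L (suc (length s)) P)) P) spread≡) no-boxes)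
    where
    T₁ : Tiling L
    T₁ = spreadTiling L (ballotSpreadPt L (length s)) T
    spread≡ : Tiling.top T₁ ≡ pathOf (s ++ [ U ])
    spread≡ = trans (cong (concatMap (ballotSpreadPt L (length s))) top≡) (ballotSpread-appends-up 0 (+ 0) s)
    no-boxes : map (boxLifts (upBoxes L (suc (length s)) (pathOf (s ++ [ U ])))) (pathOf (s ++ [ U ])) ≡ pathOf (s ++ [ U ])
    no-boxes rewrite upBoxes-none (suc (length s)) 0 (+ 0) (s ++ [ U ]) (≤-reflexive (length-snoc s U)) =
      map-id (pathOf (s ++ [ U ]))

  dyckInsertion : ∀ p s (T : Tiling L) → p ≤ length s → Tiling.top T ≡ pathOf s →
    let T₁ = spreadTiling L (dyckSpreadPt L p) T in
    ∃ λ v → moveDToEnd L (suc p) (insertUD L p s) ≡ v ++ [ D ]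
          × Tiling.top (addBoxes L (upBoxes L (suc (suc p)) (Tiling.top T₁)) false T₁) ≡ pathOf (v ++ [ D ])
          × length v ≡ suc (length s)
  dyckInsertion p s T p≤s top≡
    with take p s | drop p s | take++drop≡id p s | trans (length-take p s) (m≤n⇒m⊓n≡m p≤s)
  ... | A | B | refl | refl = A ++ U ∷ B , moveDToEnd-peak A B , dyckInsertion-top A B T top≡ , length-++-sucʳ A U B

  open NatLabelCirc L

  weight : Fin m → ℕ
  weight i = if dotted L i then 1 else 2

  dotted⇒uncircled : ∀ i → dotted L i ≡ true → circled i ≡ false
  dotted⇒uncircled i dot with circled i in circ
  ... | false = refl
  ... | true  = contradiction (trans (sym dot) (≤ᵇ-false (<⇒≱ (circled-undotted i circ)))) λ ()

  step-top : ∀ s (T : Tiling L) i → Tiling.top T ≡ pathOf s →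
    (dotted L i ≡ true → hist L i ≡ length s) → hist L i ≤ length s →
    pathOf (σStep L s i) ≡ Tiling.top (dtsStep L T i) × length (σStep L s i) ≡ length s + weight i
  step-top s T i top≡ hist≡ hist≤ with dotted L i in dot
  ... | true rewrite hist≡ refl | dotted⇒uncircled i dot =
    sym (ballotInsertion-top s T top≡) , trans (length-snoc s U) (+-comm 1 (length s))
  ... | false with dyckInsertion (hist L i) s T hist≤ top≡ | circled i
  ...   | v , σ≡ , top′ , len | false =
    trans (cong pathOf σ≡) (sym top′) , trans (cong length σ≡) (length-snoc-two v D len)
  ...   | v , σ≡ , top′ , len | true =
    trans (cong pathOf starred) (sym (addStarBox-top _ v top′)) , trans (cong length starred) (length-snoc-two v U len)
    where
    starred : replaceLastD L (moveDToEnd L (suc (hist L i)) (insertUD L (hist L i) s)) ≡ v ++ [ U ]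
    starred = trans (cong (replaceLastD L) σ≡) (replaceLastD-snoc v)

  up<length : ∀ i → up i < length w
  up<length i = ≰⇒> (λ len≤up → noUpAfter w (up i) len≤up (proj₁ (isEdge i)))
    where
    noUpAfter : ∀ (u : Word) k → length u ≤ k → at (u ++ replicate n' D) k ≢ just U
    noUpAfter []      k       _         = onlyDs n' k
      where
      onlyDs : ∀ r k → at (replicate r D) k ≢ just U
      onlyDs zero    k       ()
      onlyDs (suc r) zero    ()
      onlyDs (suc r) (suc k) = onlyDs r k
    noUpAfter (_ ∷ u) (suc k) (s≤s u≤k) = noUpAfter u k u≤k

  up<dn : ∀ i → up i < dn i
  up<dn i with isEdge i
  ... | _ , _ , ui<di , _ = ui<di

  dotted⇒length≤dn : ∀ i → dotted L i ≡ true → length w ≤ dn i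
  dotted⇒length≤dn i dot = ≮⇒≥ (λ dn<len → contradiction (trans (sym dot) (≤ᵇ-false (<⇒≱ dn<len))) λ ())

  undotted⇒dn<length : ∀ i → dotted L i ≡ false → dn i < length w
  undotted⇒dn<length i undot = ≰⇒> (λ len≤dn → contradiction (trans (sym (≤ᵇ-true len≤dn)) undot) λ ())

  edges-laminar : ∀ i j → up i < up j → dn i < up j ⊎ dn j < dn i
  edges-laminar i j ui<uj with dn i <? up j | dn j <? dn i | isEdge i | isEdge j
  ... | yes di<uj | _         | _ | _ = inj₁ di<uj
  ... | no _      | yes dj<di | _ | _ = inj₂ dj<di
  ... | no di≮uj  | no dj≮di  | _ , _ , _ , return-i , above-i | _ , _ , _ , return-j , above-j =
    ⊥-elim (ℤ.<-irrefl refl (ℤ.<-≤-trans (above-i (up j) ui<uj (≮⇒≥ di≮uj)) j-not-above))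
    where
    h : ℕ → ℤ
    h = heightAt (bar n' w)
    j-not-above : h (up j) ℤ.≤ h (up i)
    j-not-above with m≤n⇒m<n∨m≡n (≮⇒≥ dj≮di)
    ... | inj₁ di<dj = ℤ.<⇒≤ (subst (h (up j) ℤ.<_) return-i (above-j (suc (dn i)) (s≤s (≮⇒≥ di≮uj)) di<dj))
    ... | inj₂ di≡dj = ℤ.≤-reflexive (trans (sym return-j) (trans (cong (h ∘ suc) (sym di≡dj)) return-i))

  earlier-than-dotted : ∀ i j → dotted L i ≡ true → toℕ j < toℕ i → dn j < up i ⊎ (up j < up i × dn i < dn j)
  earlier-than-dotted i j dot j<i with <-cmp (up j) (up i)
  ... | tri≈ _ uj≡ui _ = ⊥-elim (<-irrefl (cong toℕ (injective j i uj≡ui)) j<i)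
  ... | tri< uj<ui _ _ with edges-laminar j i uj<ui
  ...   | inj₁ dj<ui = inj₁ dj<ui
  ...   | inj₂ di<dj = inj₂ (uj<ui , di<dj)
  earlier-than-dotted i j dot j<i | tri> _ _ ui<uj with edges-laminar i j ui<uj
  ...   | inj₁ di<uj = ⊥-elim (<⇒≱ (<-trans di<uj (up<length j)) (dotted⇒length≤dn i dot))
  ...   | inj₂ dj<di = ⊥-elim (<-asym j<i (increasing j i ui<uj dj<di))

  contribution : Fin m → Fin m → ℕ
  contribution i j = 2 * fromBool (strictlyLeft L j i) + fromBool (ancestor L j i)

  weight-undotted : ∀ j → dotted L j ≡ false → weight j ≡ 2
  weight-undotted j undot = cong (λ b → if b then 1 else 2) undot

  left⇒undotted : ∀ i j → dn j < up i → dotted L j ≡ false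
  left⇒undotted i j dj<ui = ≤ᵇ-false (<⇒≱ (<-trans dj<ui (up<length i)))

  contribution-of-left : ∀ i j → dn j < up i → contribution i j ≡ 2
  contribution-of-left i j dj<ui
    rewrite <ᵇ-true dj<ui | <ᵇ-false (<-asym (<-trans dj<ui (up<dn i))) | ∧-zeroʳ (up j <ᵇ up i) = refl

  contribution≤weight : ∀ i j → contribution i j ≤ weight j
  contribution≤weight i j with dn j <? up i
  ... | yes dj<ui = ≤-reflexive (trans (contribution-of-left i j dj<ui) (sym (weight-undotted j (left⇒undotted i j dj<ui))))
  ... | no  dj≮ui rewrite <ᵇ-false dj≮ui = ≤-trans (fromBool≤1 (ancestor L j i)) weight≥1
    where
    fromBool≤1 : ∀ b → fromBool b ≤ 1
    fromBool≤1 true  = ≤-refl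
    fromBool≤1 false = z≤n
    weight≥1 : 1 ≤ weight j
    weight≥1 with dotted L j
    ... | true  = ≤-refl
    ... | false = s≤s z≤n

  contribution-of-dotted : ∀ i j → dotted L i ≡ true → toℕ j < toℕ i → contribution i j ≡ weight j
  contribution-of-dotted i j dot j<i with earlier-than-dotted i j dot j<i
  ... | inj₁ dj<ui = trans (contribution-of-left i j dj<ui) (sym (weight-undotted j (left⇒undotted i j dj<ui)))
  ... | inj₂ (uj<ui , di<dj) with dotted L j in dot-j
  ...   | false = ⊥-elim (<⇒≱ (<-trans di<dj (undotted⇒dn<length j dot-j)) (dotted⇒length≤dn i dot))
  ...   | true rewrite <ᵇ-false (<-asym (<-≤-trans (up<length i) (dotted⇒length≤dn j dot-j)))
                     | <ᵇ-true uj<ui | <ᵇ-true di<dj = refl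

  countB-∷ : ∀ {A : Set} (P : A → Bool) x xs → countB L P (x ∷ xs) ≡ fromBool (P x) + countB L P xs
  countB-∷ P x xs with P x
  ... | true  = refl
  ... | false = refl

  countB-++ : ∀ {A : Set} (P : A → Bool) xs ys → countB L P (xs ++ ys) ≡ countB L P xs + countB L P ys
  countB-++ P []       ys = refl
  countB-++ P (x ∷ xs) ys
    rewrite countB-∷ P x (xs ++ ys) | countB-∷ P x xs | countB-++ P xs ys = sym (+-assoc (fromBool (P x)) _ _)

  countB-∧-true : ∀ {A : Set} (Q P : A → Bool) xs → All (λ x → Q x ≡ true) xs →
    countB L (λ x → Q x ∧ P x) xs ≡ countB L P xs
  countB-∧-true Q P []       []           = refl
  countB-∧-true Q P (x ∷ xs) (Qx ∷ Qxs) rewrite Qx | countB-∧-true Q P xs Qxs = refl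

  countB-∧-false : ∀ {A : Set} (Q P : A → Bool) xs → All (λ x → Q x ≡ false) xs →
    countB L (λ x → Q x ∧ P x) xs ≡ 0
  countB-∧-false Q P []       []           = refl
  countB-∧-false Q P (x ∷ xs) (¬Qx ∷ ¬Qxs) rewrite ¬Qx = countB-∧-false Q P xs ¬Qxs

  count-before : ∀ i (P : Fin m → Bool) ys zs → All (λ j → toℕ j < toℕ i) ys → All (λ j → toℕ i < toℕ j) zs →
    countB L (λ j → (toℕ j <ᵇ toℕ i) ∧ P j) (ys ++ i ∷ zs) ≡ countB L P ys
  count-before i P ys zs before after = begin
    countB L (λ j → Q j ∧ P j) (ys ++ i ∷ zs)
      ≡⟨ countB-++ (λ j → Q j ∧ P j) ys (i ∷ zs) ⟩
    countB L (λ j → Q j ∧ P j) ys + countB L (λ j → Q j ∧ P j) (i ∷ zs)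
      ≡⟨ cong₂ _+_ (countB-∧-true Q P ys (All.map <ᵇ-true before)) (countB-∧-false Q P (i ∷ zs) not-before) ⟩
    countB L P ys + 0
      ≡⟨ +-identityʳ _ ⟩
    countB L P ys
      ∎
    where
    open ≡-Reasoning
    Q : Fin m → Bool
    Q j = toℕ j <ᵇ toℕ i
    not-before : All (λ j → Q j ≡ false) (i ∷ zs)
    not-before = <ᵇ-false (<-irrefl {toℕ i} refl) ∷ All.map (<ᵇ-false ∘ <-asym) after

  weighted-count : ∀ i ys →
    2 * countB L (λ j → strictlyLeft L j i) ys + countB L (λ j → ancestor L j i) ys ≡ sum (map (contribution i) ys)
  weighted-count i []       = refl
  weighted-count i (j ∷ ys)
    rewrite countB-∷ (λ j → strictlyLeft L j i) j ys | countB-∷ (λ j → ancestor L j i) j ys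
          | sym (weighted-count i ys) =
    regroup (fromBool (strictlyLeft L j i)) (countB L (λ j → strictlyLeft L j i) ys)
            (fromBool (ancestor L j i)) (countB L (λ j → ancestor L j i) ys)
    where
    regroup : ∀ a b c d → 2 * (a + b) + (c + d) ≡ (2 * a + c) + (2 * b + d)
    regroup = solve-∀

  hist-as-sum : ∀ ys i zs → ys ++ i ∷ zs ≡ allFin m → hist L i ≡ sum (map (contribution i) ys)
  hist-as-sum ys i zs split rewrite sym split with allFin-split ys i zs split
  ... | before , after
    rewrite count-before i (λ j → strictlyLeft L j i) ys zs before after
          | count-before i (λ j → ancestor L j i) ys zs before after = weighted-count i ys

  weights : List (Fin m) → ℕ
  weights ys = sum (map weight ys)

  hist≤weights : ∀ ys i zs → ys ++ i ∷ zs ≡ allFin m → hist L i ≤ weights ys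
  hist≤weights ys i zs split = ≤-trans (≤-reflexive (hist-as-sum ys i zs split)) (sum-map-≤ ys)
    where
    sum-map-≤ : ∀ ys → sum (map (contribution i) ys) ≤ weights ys
    sum-map-≤ []       = z≤n
    sum-map-≤ (j ∷ ys) = +-mono-≤ (contribution≤weight i j) (sum-map-≤ ys)

  hist-of-dotted : ∀ ys i zs → ys ++ i ∷ zs ≡ allFin m → dotted L i ≡ true → hist L i ≡ weights ys
  hist-of-dotted ys i zs split dot =
    trans (hist-as-sum ys i zs split)
          (cong sum (map-cong-local (All.map (contribution-of-dotted i _ dot) (proj₁ (allFin-split ys i zs split)))))

  weights-snoc : ∀ ys i → weights (ys ++ [ i ]) ≡ weights ys + weight i
  weights-snoc ys i rewrite map-++ weight ys [ i ] | sum-++ (map weight ys) [ weight i ] | +-identityʳ (weight i) = refl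

  symDTS-tracks-sigma : ∀ ys zs s (T : Tiling L) → ys ++ zs ≡ allFin m →
    Tiling.top T ≡ pathOf s → length s ≡ weights ys →
    pathOf (foldl (σStep L) s zs) ≡ Tiling.top (foldl (dtsStep L) T zs)
  symDTS-tracks-sigma ys []       s T _     top≡ _    = sym top≡
  symDTS-tracks-sigma ys (i ∷ zs) s T split top≡ len≡ =
    symDTS-tracks-sigma (ys ++ [ i ]) zs (σStep L s i) (dtsStep L T i) (trans (++-assoc ys [ i ] zs) split)
      (sym (proj₁ step)) (trans (proj₂ step) (trans (cong (_+ weight i) len≡) (sym (weights-snoc ys i))))
    where
    step : pathOf (σStep L s i) ≡ Tiling.top (dtsStep L T i) × length (σStep L s i) ≡ length s + weight i
    step = step-top s T i top≡
      (λ dot → trans (hist-of-dotted ys i zs split dot) (sym len≡))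
      (≤-trans (hist≤weights ys i zs split) (≤-reflexive (sym len≡)))

proposition4p11 : (n n' : ℕ) (w : Word) → IsBallot n n' w →
    (L : NatLabelCirc w n' (n + n')) →
    pathOf (sigma L) ≡ Tiling.top (symDTS L)
proposition4p11 n n' w _ L = symDTS-tracks-sigma L [] (allFin (n + n')) [] (emptyTiling L) refl refl refl
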